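{- Let $\mathrm{distinct}:\mathrm{Bag}(\tau)\to\mathrm{Bag}(\tau)$ be the function removing duplicates from a bag (each distinct element kept exactly once). Then for every monoid homomorphism $\phi:\mathrm{Bag}(\tau)\to\mathrm{Bag}(\tau)$, $\phi$ is compatible with $\mathrm{distinct}$, i.e. $\mathrm{distinct}\circ\phi\circ\mathrm{distinct}=\mathrm{distinct}\circ\phi$.
   Context: $\mathrm{Bag}(\tau)$ denotes the monoid of finite bags of values of type $\tau$ under bag union $\uplus$ with neutral element the empty bag; a monoid homomorphism $\phi$ satisfies $\phi(\{\!\!\})=\{\!\!\}$ and $\phi(a\uplus b)=\phi(a)\uplus\phi(b)$. $\phi$ is said to be compatible with an aggregation function $\delta$ when $\delta\circ\phi\circ\delta=\delta\circ\phi$ (equivalently, $\delta(a)=\delta(b)$ implies $\delta(\phi(a))=\delta(\phi(b))$). -}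

module Defs where

open import Level using (Level)
open import Data.List using (List; []; _++_; deduplicate)
open import Data.List.Relation.Binary.Permutation.Propositional using (_↭_)
open import Relation.Binary.PropositionalEquality using (_≡_)
open import Relation.Binary.Definitions using (DecidableEquality)

-- A finite bag over τ is represented by a list, considered up to
-- permutation (_↭_), which is exactly bag equality.
Bag : ∀ {a} → Set a → Set a
Bag τ = List τ

_⊎ᴮ_ : ∀ {a} {τ : Set a} → Bag τ → Bag τ → Bag τ
_⊎ᴮ_ = _++_

distinct : ∀ {a} {τ : Set a} → DecidableEquality τ → Bag τ → Bag τ
distinct _≟_ = deduplicate _≟_

record IsBagMonoidHom {a} {τ : Set a} (φ : Bag τ → Bag τ) : Set a where
  field
    φ-cong : ∀ {xs ys} → xs ↭ ys → φ xs ↭ φ ys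
    φ-ε    : φ [] ↭ []
    φ-∙    : ∀ xs ys → φ (xs ⊎ᴮ ys) ↭ (φ xs ⊎ᴮ φ ys)

Compatible : ∀ {a} {τ : Set a} → (Bag τ → Bag τ) → (Bag τ → Bag τ) → Set a
Compatible φ δ = ∀ xs → δ (φ (δ xs)) ↭ δ (φ xs)

{-# OPTIONS --safe #-}
module Submission where

-- A bag homomorphism is determined by its values on singletons,
-- φ xs ↭ concatMap (φ ∘ [_]) xs, so the elements of φ xs depend only on the
-- elements of xs, which deduplication does not change.  Two duplicate-free
-- lists with the same elements are permutations of each other.

open import Relation.Binary.Definitions using (DecidableEquality)
open import Defs

open import Data.List using (List; []; _∷_; [_]; concatMap; deduplicate)
open import Data.List.Membership.Propositional.Properties using (deduplicate-∈⇔)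
open import Data.List.Membership.Propositional.Properties.WithK using (unique∧set⇒bag)
open import Data.List.Relation.Binary.BagAndSetEquality
  using (_∼[_]_; set; [_]-Equality; bag-=⇒; ↭⇒∼bag; ∼bag⇒↭; >>=-cong)
open import Data.List.Relation.Binary.Permutation.Propositional
  using (_↭_; module PermutationReasoning)
open import Data.List.Relation.Binary.Permutation.Propositional.Properties using (++⁺ˡ)
open import Data.List.Relation.Unary.Unique.DecPropositional.Properties using (deduplicate-!)
open import Function.Base using (_∘_)
open import Function.Properties.Equivalence using () renaming (refl to ⇔-refl; sym to ⇔-sym)
import Relation.Binary.Reasoning.Setoid as SetoidReasoning

↭⇒∼set : ∀ {a} {A : Set a} {xs ys : List A} → xs ↭ ys → xs ∼[ set ] ys
↭⇒∼set = bag-=⇒ ∘ ↭⇒∼bag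

module _ {a} {τ : Set a} {φ : Bag τ → Bag τ} (hom : IsBagMonoidHom φ) where
  open IsBagMonoidHom hom

  hom-↭-concatMap : ∀ xs → φ xs ↭ concatMap (φ ∘ [_]) xs
  hom-↭-concatMap []       = φ-ε
  hom-↭-concatMap (x ∷ xs) = begin
    φ ([ x ] ⊎ᴮ xs)               ↭⟨ φ-∙ [ x ] xs ⟩
    φ [ x ] ⊎ᴮ φ xs               ↭⟨ ++⁺ˡ (φ [ x ]) (hom-↭-concatMap xs) ⟩
    concatMap (φ ∘ [_]) (x ∷ xs)  ∎
    where open PermutationReasoning

  hom-cong-∼set : ∀ {xs ys} → xs ∼[ set ] ys → φ xs ∼[ set ] φ ys
  hom-cong-∼set {xs} {ys} xs∼ys = begin
    φ xs                    ≈⟨ ↭⇒∼set (hom-↭-concatMap xs) ⟩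
    concatMap (φ ∘ [_]) xs  ≈⟨ >>=-cong xs∼ys (λ _ → ⇔-refl) ⟩
    concatMap (φ ∘ [_]) ys  ≈⟨ ↭⇒∼set (hom-↭-concatMap ys) ⟨
    φ ys                    ∎
    where open SetoidReasoning ([ set ]-Equality τ)

module _ {a} {τ : Set a} (_≟_ : DecidableEquality τ) where

  deduplicate-∼set : (xs : List τ) → deduplicate _≟_ xs ∼[ set ] xs
  deduplicate-∼set _ = ⇔-sym (deduplicate-∈⇔ _≟_)

  deduplicate-cong-∼set : ∀ {xs ys : List τ} → xs ∼[ set ] ys →
                          deduplicate _≟_ xs ↭ deduplicate _≟_ ys
  deduplicate-cong-∼set {xs} {ys} xs∼ys =
    ∼bag⇒↭ (unique∧set⇒bag (deduplicate-! _≟_ xs) (deduplicate-! _≟_ ys) (begin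
      deduplicate _≟_ xs  ≈⟨ deduplicate-∼set xs ⟩
      xs                  ≈⟨ xs∼ys ⟩
      ys                  ≈⟨ deduplicate-∼set ys ⟨
      deduplicate _≟_ ys  ∎))
    where open SetoidReasoning ([ set ]-Equality τ)

mainTheorem4 : ∀ {a} {τ : Set a} (_≟_ : DecidableEquality τ) (φ : Bag τ → Bag τ) →
    IsBagMonoidHom φ → Compatible φ (distinct _≟_)
mainTheorem4 _≟_ φ hom xs =
  deduplicate-cong-∼set _≟_ (hom-cong-∼set hom (deduplicate-∼set _≟_ xs))
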